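{- Let $\boldsymbol{\theta}\in\widetilde{\mathcal{K}}^d$ and assume that $\mathbf{u}\in Q$ is a best approximation of $\boldsymbol{\theta}$. Then for every $\mathbf{v}\in Q$ such that $|\mathbf{v}|\le|\mathbf{u}|$ and $\mathbf{v}\notin\mathbb{F}_q^*\mathbf{u}$, we have $A(\boldsymbol{\theta},\mathbf{v})=A(\hat{\mathbf{u}},\mathbf{v})$.
   Context: $q$ a prime power, $\mathcal{R}=\mathbb{F}_q[x]$, $\mathcal{K}=\mathbb{F}_q(x)$ with $|f/g|=q^{\deg f-\deg g}$, $\widetilde{\mathcal{K}}=\mathbb{F}_q((x^{ -1}))$ its completion, $\widetilde{\mathcal{K}}^d$ with sup norm $\|\cdot\|$. $Q=\{(a_1,\dots,a_d,b)\in\mathcal{R}^{d+1}:\gcd(a_1,\dots,a_d,b)=1,\ b\neq0\}$; for $\mathbf{u}=(\mathbf{a},b)\in Q$, $\hat{\mathbf{u}}=\mathbf{a}/b$, $|\mathbf{u}|=|b|$, and for $\boldsymbol{\theta}\in\widetilde{\mathcal{K}}^d$, $A(\boldsymbol{\theta},\mathbf{u})=\|b\boldsymbol{\theta}-\mathbf{a}\|$. $\mathbf{u}\in Q$ is a best approximation of $\boldsymbol{\theta}$ if $A(\boldsymbol{\theta},\mathbf{u})<A(\boldsymbol{\theta},\mathbf{v})$ for every $\mathbf{v}\in Q$ with $|\mathbf{v}|<|\mathbf{u}|$, and $A(\boldsymbol{\theta},\mathbf{u})\le A(\boldsymbol{\theta},\mathbf{v})$ for every $\mathbf{v}\in Q$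 with $|\mathbf{v}|\le|\mathbf{u}|$. -}

module Defs where

open import Level using (0ℓ)
open import Algebra.Bundles using (CommutativeRing)
open import Data.Nat as ℕ using (ℕ; zero; suc)
open import Data.Integer as ℤ using (ℤ; +_; -[1+_])
open import Data.Fin using (Fin)
open import Data.List using (List; []; _∷_; map)
open import Data.Maybe using (Maybe; just; nothing)
open import Data.Product using (∃; Σ; _×_; _,_)
open import Data.Unit using (⊤)
open import Data.Empty using (⊥)
open import Relation.Nullary using (¬_; yes; no)
open import Relation.Binary using (Decidable)
open import Relation.Binary.PropositionalEquality using (_≡_)

-- A finite field 𝔽_q: a commutative ring with decidable equality in which
-- 1 ≠ 0 and every nonzero element is invertible, whose carrier is in
-- bijection (up to ≈) with Fin q.  (q is then automatically a prime power.)
record FiniteField : Set₁ where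
  field
    cring : CommutativeRing 0ℓ 0ℓ
  open CommutativeRing cring public
  field
    _≟_       : Decidable _≈_
    1≉0       : ¬ (1# ≈ 0#)
    inverse   : ∀ x → ¬ (x ≈ 0#) → ∃ λ y → x * y ≈ 1#
    q         : ℕ
    enum      : Fin q → Carrier
    enum-surj : ∀ x → ∃ λ i → enum i ≈ x
    enum-inj  : ∀ i j → enum i ≈ enum j → i ≡ j

module _ (F : FiniteField) where
  open FiniteField F

  -- Polynomials 𝓡 = 𝔽_q[x]: coefficient lists, lowest degree first.
  Poly : Set
  Poly = List Carrier

  coeffP : Poly → ℕ → Carrier
  coeffP []       _       = 0#
  coeffP (c ∷ cs) zero    = c
  coeffP (c ∷ cs) (suc k) = coeffP cs k

  _≈P_ : Poly → Poly → Set
  p ≈P p' = ∀ k → coeffP p k ≈ coeffP p' k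

  addP : Poly → Poly → Poly
  addP []       p'        = p'
  addP (c ∷ cs) []        = c ∷ cs
  addP (c ∷ cs) (c' ∷ cs') = (c + c') ∷ addP cs cs'

  scaleP : Carrier → Poly → Poly
  scaleP c p = map (c *_) p

  negP : Poly → Poly
  negP p = map -_ p

  subP : Poly → Poly → Poly
  subP p p' = addP p (negP p')

  mulP : Poly → Poly → Poly
  mulP []       p' = []
  mulP (c ∷ cs) p' = addP (scaleP c p') (0# ∷ mulP cs p')

  oneP : Poly
  oneP = 1# ∷ []

  _∣P_ : Poly → Poly → Set
  g ∣P f = ∃ λ h → mulP g h ≈P f

  IsUnitP : Poly → Set
  IsUnitP g = ∃ λ h → mulP g h ≈P oneP

  -- degree; nothing = degree of the zero polynomial (−∞)
  deg : Poly → Maybe ℕ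
  deg []       = nothing
  deg (c ∷ cs) with deg cs
  ... | just n  = just (suc n)
  ... | nothing with c ≟ 0#
  ...   | yes _ = nothing
  ...   | no  _ = just 0

  -- order on degrees with nothing = −∞ (so |f| ≤ |g| iff deg f ≤ deg g)
  _≤ᴰ_ : Maybe ℕ → Maybe ℕ → Set
  nothing ≤ᴰ _       = ⊤
  just m  ≤ᴰ nothing = ⊥
  just m  ≤ᴰ just n  = m ℕ.≤ n

  _<ᴰ_ : Maybe ℕ → Maybe ℕ → Set
  m <ᴰ n = ¬ (n ≤ᴰ m)

  -- Norm values in {0} ∪ q^ℤ are represented by the (upward closed)
  -- predicate  n ↦ "value ≤ q^n"  on ℤ.
  NormPred : Set₁
  NormPred = ℤ → Set

  _≤ᴺ_ : NormPred → NormPred → Set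
  P ≤ᴺ P' = ∀ n → P' n → P n

  _<ᴺ_ : NormPred → NormPred → Set
  P <ᴺ P' = ∃ λ n → P n × ¬ P' n

  _≡ᴺ_ : NormPred → NormPred → Set
  P ≡ᴺ P' = ∀ n → (P n → P' n) × (P' n → P n)

  -- Laurent series 𝔽_q((x⁻¹)): coefficient of x^e for e ∈ ℤ, vanishing
  -- above some bound.
  record Laurent : Set where
    field
      coeff  : ℤ → Carrier
      bound  : ℤ
      vanish : ∀ e → bound ℤ.< e → coeff e ≈ 0#
  open Laurent public

  mulPS : Poly → Laurent → ℤ → Carrier
  mulPS []       θ e = 0#
  mulPS (c ∷ cs) θ e = c * coeff θ e + mulPS cs θ (e ℤ.- + 1)

  polyAt : Poly → ℤ → Carrier
  polyAt a (+ n)    = coeffP a n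
  polyAt a -[1+ n ] = 0#

  -- |s| ≤ q^n for a Laurent series given by its coefficient function
  seriesLe : (ℤ → Carrier) → NormPred
  seriesLe s n = ∀ e → n ℤ.< e → s e ≈ 0#

  -- |f/g| ≤ q^n in 𝒦 = 𝔽_q(x), with |f/g| = q^(deg f − deg g)  (g ≠ 0)
  ratLe : Poly → Poly → NormPred
  ratLe f g n with deg f | deg g
  ... | nothing | _       = ⊤
  ... | just m  | just k  = (+ m) ℤ.- (+ k) ℤ.≤ n
  ... | just m  | nothing = ⊥

  record QElem (d : ℕ) : Set where
    field
      a        : Fin d → Poly
      b        : Poly
      coprime  : ∀ g → (∀ i → g ∣P a i) → g ∣P b → IsUnitP g
      b≢0      : ¬ (∀ k → coeffP b k ≈ 0#)
  open QElem public

  -- |u| = |b|, compared through degrees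
  _≤Q_ : ∀ {d} → QElem d → QElem d → Set
  v ≤Q u = deg (b v) ≤ᴰ deg (b u)

  _<Q_ : ∀ {d} → QElem d → QElem d → Set
  v <Q u = deg (b v) <ᴰ deg (b u)

  A : ∀ {d} → (Fin d → Laurent) → QElem d → NormPred
  A θ u n = ∀ i → seriesLe (λ e → mulPS (b u) (θ i) e - polyAt (a u i) e) n

  -- A(û,v) = ‖b_v·(a_u/b_u) − a_v‖ = max_i |(b_v a_{u,i} − a_{v,i} b_u)/b_u|
  Ahat : ∀ {d} → QElem d → QElem d → NormPred
  Ahat u v n = ∀ i → ratLe (subP (mulP (b v) (a u i)) (mulP (a v i) (b u))) (b u) n

  InScalarMultiples : ∀ {d} → QElem d → QElem d → Set
  InScalarMultiples v u =
    ∃ λ c → ¬ (c ≈ 0#) × (∀ i → a v i ≈P scaleP c (a u i)) × (b v ≈P scaleP c (b u))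

  IsBestApprox : ∀ {d} → (Fin d → Laurent) → QElem d → Set
  IsBestApprox θ u =
    (∀ v → v <Q u → A θ u <ᴺ A θ v) × (∀ v → v ≤Q u → A θ u ≤ᴺ A θ v)

{-# OPTIONS --safe #-}
module Submission where

-- Write R_w = b_w θ − a_w, so that A(θ,w) = ‖R_w‖, and D = b_v a_u − a_v b_u, so that
-- A(û,v) = ‖D‖ / |b_u|.  As b_u R_v = b_v R_u + D, the ultrametric inequality gives the
-- claim as soon as ‖b_v R_u‖ < ‖D‖.  Otherwise ‖D‖ ≤ ‖b_v R_u‖ ≤ |b_u| A(θ,u), whence
-- A(θ,v) ≤ A(θ,u), and a best approximation u forbids this for v ∉ 𝔽_q^* u: subtracting
-- from v the multiple c u that cancels the top coefficient of b_v leaves w with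
-- |b_w| < |b_u| and A(θ,w) ≤ A(θ,u).  If b_w = 0, then A(θ,u) < 1 (compare u with the
-- polynomial part of θ) forces a_w = 0, i.e. v = c u; otherwise dividing w by the gcd
-- of its entries yields an element of Q with |b| < |b_u| that is at least as close to θ.

open import Defs
open import Level using (0ℓ)
open import Data.Nat as ℕ using (ℕ; zero; suc; z≤n; s≤s)
import Data.Nat.Properties as ℕP
open import Data.Integer as ℤ using (ℤ; +_; -[1+_]; +<+; +≤+; pred)
import Data.Integer.Properties as ℤP
import Data.Integer.Tactic.RingSolver as ℤ-Solver
open import Data.Fin using (Fin; zero; suc)
open import Data.Fin.Properties using (all?; ¬∀⟶∃¬)
open import Data.Vec.Functional using () renaming (_∷_ to _∷ᶠ_)
open import Data.Nat.Induction using (<-wellFounded)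
open import Induction.WellFounded using (Acc; acc)
open import Data.List using ([]; _∷_; length; applyUpTo)
open import Data.Product using (∃; ∃₂; _×_; _,_; proj₁; proj₂)
open import Data.Sum using (_⊎_; inj₁; inj₂)
open import Data.Maybe using (Maybe; just; nothing)
open import Data.Empty using (⊥-elim)
open import Data.Unit using (tt)
open import Function using (_∘_; _⇔_; mk⇔; Equivalence; case_of_)
open import Relation.Nullary using (¬_; yes; no; Dec)
open import Relation.Binary using (Setoid)
import Relation.Binary.Reasoning.Setoid as SetoidReasoning
open import Function.Properties.Equivalence using (⇔-setoid)
open import Relation.Binary.PropositionalEquality as ≡ using (_≡_)

pred[i+1+k]≡i+k : ∀ i k → pred (i ℤ.+ + suc k) ≡ i ℤ.+ + k
pred[i+1+k]≡i+k i k = -1+[i+[1+k]]≡i+k i (+ k)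
  where
  -1+[i+[1+k]]≡i+k : ∀ i k → ℤ.- + 1 ℤ.+ (i ℤ.+ (+ 1 ℤ.+ k)) ≡ i ℤ.+ k
  -1+[i+[1+k]]≡i+k = ℤ-Solver.solve-∀

i<i+1+k : ∀ i k → i ℤ.< i ℤ.+ + suc k
i<i+1+k i k = ℤP.i≤pred[j]⇒i<j (≡.subst (i ℤ.≤_) (≡.sym (pred[i+1+k]≡i+k i k)) (ℤP.i≤i+j i (+ k)))

∀-⇔ : ∀ {a p q} {A : Set a} {P : A → Set p} {Q : A → Set q} →
  (∀ x → P x ⇔ Q x) → (∀ x → P x) ⇔ (∀ x → Q x)
∀-⇔ P⇔Q = mk⇔ (λ P x → Equivalence.to (P⇔Q x) (P x)) (λ Q x → Equivalence.from (P⇔Q x) (Q x))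

∣i∣<k⇒i<+k : ∀ i {k} → ℤ.∣ i ∣ ℕ.< k → i ℤ.< + k
∣i∣<k⇒i<+k (+ _)      ∣i∣<k = +<+ ∣i∣<k
∣i∣<k⇒i<+k -[1+ _ ] _     = ℤ.-<+

pred[i]<i : ∀ i → pred i ℤ.< i
pred[i]<i i = ℤP.i≤pred[j]⇒i<j ℤP.≤-refl

pred-monoʳ-< : ∀ {i j} → i ℤ.< j → i ℤ.≤ pred j
pred-monoʳ-< {i} i<j = ≡.subst (ℤ._≤ _) (ℤP.pred-suc i) (ℤP.pred-mono (ℤP.i<j⇒suc[i]≤j i<j))

pred<⇒≤ : ∀ {i j} → pred i ℤ.< j → i ℤ.≤ j
pred<⇒≤ {i} lt = ≡.subst (ℤ._≤ _) (ℤP.suc-pred i) (ℤP.i<j⇒suc[i]≤j lt)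

downward-induction : ∀ {ℓ} (P : ℤ → Set ℓ) {n B : ℤ} →
  (∀ {i j} → i ℤ.≤ j → P i → P j) →
  (∀ N → n ℤ.< N → P N → P (pred N)) →
  P B → P n
downward-induction P {n} {B} mono step PB = descend ∣B⊔n-n∣ (≡.subst P B⊔n≡ (mono (ℤP.i≤i⊔j B n) PB))
  where
  ∣B⊔n-n∣ : ℕ
  ∣B⊔n-n∣ = ℤ.∣ B ℤ.⊔ n ℤ.- n ∣
  B⊔n≡ : B ℤ.⊔ n ≡ n ℤ.+ + ∣B⊔n-n∣
  B⊔n≡ = ≡.trans (≡.sym (n+[m-n]≡m n (B ℤ.⊔ n)))
                 (≡.cong (λ x → n ℤ.+ x) (≡.sym (ℤP.0≤i⇒+∣i∣≡i (ℤP.i≤j⇒0≤j-i (ℤP.i≤j⊔i B n)))))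
    where
    n+[m-n]≡m : ∀ n m → n ℤ.+ (m ℤ.- n) ≡ m
    n+[m-n]≡m = ℤ-Solver.solve-∀
  descend : ∀ k → P (n ℤ.+ + k) → P n
  descend zero    = ≡.subst P (ℤP.+-identityʳ n)
  descend (suc k) = descend k ∘ ≡.subst P (pred[i+1+k]≡i+k n k) ∘ step _ (i<i+1+k n k)

module _ (F : FiniteField) where
  open FiniteField F hiding (zero)
  open import Algebra.Properties.Ring ring
    using ( -0#≈0#; -‿+-comm; -‿involutive; -‿distribˡ-*; -‿distribʳ-*; x[y-z]≈xy-xz
          ; x∙y⁻¹≈ε⇒x≈y; x≈y⇒x∙y⁻¹≈ε; xyx⁻¹≈y)
  open import Algebra.Properties.CommutativeSemigroup +-commutativeSemigroup using (interchange)
  open import Algebra.Properties.CommutativeSemigroup *-commutativeSemigroup using (x∙yz≈y∙xz)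
  module ≈-Reasoning = SetoidReasoning setoid

  _⁻¹⟨_⟩ : ∀ x → ¬ x ≈ 0# → Carrier
  x ⁻¹⟨ x≉0 ⟩ = proj₁ (inverse x x≉0)

  [x-y]+[y-z]≈x-z : ∀ x y z → (x - y) + (y - z) ≈ x - z
  [x-y]+[y-z]≈x-z x y z = begin
    (x - y) + (y - z)   ≈⟨ +-assoc x (- y) (y - z) ⟩
    x + (- y + (y - z)) ≈⟨ +-congˡ (sym (+-assoc (- y) y (- z))) ⟩
    x + ((- y + y) - z) ≈⟨ +-congˡ (+-congʳ (-‿inverseˡ y)) ⟩
    x + (0# - z)        ≈⟨ +-congˡ (+-identityˡ (- z)) ⟩
    x - z               ∎
    where open ≈-Reasoning

  x-[y+z]≈[x-z]-y : ∀ x y z → x - (y + z) ≈ (x - z) - y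
  x-[y+z]≈[x-z]-y x y z =
    trans (+-congˡ (trans (-‿cong (+-comm y z)) (sym (-‿+-comm z y)))) (sym (+-assoc x (- z) (- y)))

  [x-y]-[z-w]≈[x-z]-[y-w] : ∀ x y z w → (x - y) - (z - w) ≈ (x - z) - (y - w)
  [x-y]-[z-w]≈[x-z]-[y-w] x y z w = begin
    (x - y) - (z - w)     ≈⟨ +-congˡ -[x-y]≈-x+y ⟩
    (x - y) + (- z + w)   ≈⟨ interchange x (- y) (- z) w ⟩
    (x - z) + (- y + w)   ≈˘⟨ +-congˡ -[x-y]≈-x+y ⟩
    (x - z) - (y - w)     ∎
    where
    open ≈-Reasoning
    -[x-y]≈-x+y : ∀ {x y} → - (x - y) ≈ - x + y
    -[x-y]≈-x+y {x} {y} = trans (sym (-‿+-comm x (- y))) (+-congˡ (-‿involutive y))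

  x*y≈0⇒y≈0 : ∀ {x y} → ¬ x ≈ 0# → x * y ≈ 0# → y ≈ 0#
  x*y≈0⇒y≈0 {x} {y} x≉0 xy≈0 = begin
    y                            ≈⟨ sym (*-identityˡ y) ⟩
    1# * y                       ≈⟨ *-congʳ (sym (trans (*-comm _ _) (proj₂ (inverse x x≉0)))) ⟩
    (x ⁻¹⟨ x≉0 ⟩ * x) * y        ≈⟨ *-assoc _ _ _ ⟩
    x ⁻¹⟨ x≉0 ⟩ * (x * y)        ≈⟨ *-congˡ xy≈0 ⟩
    x ⁻¹⟨ x≉0 ⟩ * 0#             ≈⟨ zeroʳ _ ⟩
    0#                           ∎
    where open ≈-Reasoning

  Series : Set
  Series = ℤ → Carrier

  infix 4 _≈ₛ_
  record _≈ₛ_ (s t : Series) : Set where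
    constructor pointwise
    field at : ∀ e → s e ≈ t e
  open _≈ₛ_ public

  ≈ₛ-setoid : Setoid 0ℓ 0ℓ
  ≈ₛ-setoid = record
    { _≈_           = _≈ₛ_
    ; isEquivalence = record
      { refl  = pointwise λ _ → refl
      ; sym   = λ s≈t → pointwise (sym ∘ at s≈t)
      ; trans = λ s≈t t≈u → pointwise λ e → trans (at s≈t e) (at t≈u e)
      }
    }

  module ≈ₛ-Reasoning = SetoidReasoning ≈ₛ-setoid
  open Setoid ≈ₛ-setoid public using () renaming (refl to ≈ₛ-refl; sym to ≈ₛ-sym; trans to ≈ₛ-trans)

  infixl 6 _+ₛ_ _-ₛ_
  infix  8 -ₛ_
  infixr 7 _·ₛ_

  _+ₛ_ _-ₛ_ : Series → Series → Series
  (s +ₛ t) e = s e + t e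
  (s -ₛ t) e = s e - t e

  -ₛ_ : Series → Series
  (-ₛ s) e = - s e

  _·ₛ_ : Carrier → Series → Series
  (c ·ₛ s) e = c * s e

  +ₛ-cong : ∀ {s s′ t t′} → s ≈ₛ s′ → t ≈ₛ t′ → s +ₛ t ≈ₛ s′ +ₛ t′
  +ₛ-cong s≈s′ t≈t′ = pointwise λ e → +-cong (at s≈s′ e) (at t≈t′ e)

  -ₛ-cong : ∀ {s s′ t t′} → s ≈ₛ s′ → t ≈ₛ t′ → s -ₛ t ≈ₛ s′ -ₛ t′
  -ₛ-cong s≈s′ t≈t′ = pointwise λ e → +-cong (at s≈s′ e) (-‿cong (at t≈t′ e))

  infix 4 ‖_‖≤_
  ‖_‖≤_ : Series → ℤ → Set
  ‖ s ‖≤ n = seriesLe F s n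

  infix 4 ‖_‖∞≤_
  ‖_‖∞≤_ : ∀ {d} → (Fin d → Series) → ℤ → Set
  ‖ s ‖∞≤ n = ∀ i → ‖ s i ‖≤ n

  ‖‖≤-mono : ∀ {s m n} → m ℤ.≤ n → ‖ s ‖≤ m → ‖ s ‖≤ n
  ‖‖≤-mono m≤n ‖s‖≤m e n<e = ‖s‖≤m e (ℤP.≤-<-trans m≤n n<e)

  ‖‖≤-resp : ∀ {s t n} → s ≈ₛ t → ‖ s ‖≤ n → ‖ t ‖≤ n
  ‖‖≤-resp s≈t ‖s‖≤n e n<e = trans (sym (at s≈t e)) (‖s‖≤n e n<e)

  ‖‖≤-+ₛ : ∀ {s t n} → ‖ s ‖≤ n → ‖ t ‖≤ n → ‖ s +ₛ t ‖≤ n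
  ‖‖≤-+ₛ ‖s‖≤n ‖t‖≤n e n<e = trans (+-cong (‖s‖≤n e n<e) (‖t‖≤n e n<e)) (+-identityˡ 0#)

  ‖‖≤--ₛ : ∀ {s t n} → ‖ s ‖≤ n → ‖ t ‖≤ n → ‖ s -ₛ t ‖≤ n
  ‖‖≤--ₛ ‖s‖≤n ‖t‖≤n e n<e = trans (+-cong (‖s‖≤n e n<e) (trans (-‿cong (‖t‖≤n e n<e)) -0#≈0#)) (+-identityˡ 0#)

  ‖‖≤-·ₛ : ∀ {s n} c → ‖ s ‖≤ n → ‖ c ·ₛ s ‖≤ n
  ‖‖≤-·ₛ c ‖s‖≤n e n<e = trans (*-congˡ (‖s‖≤n e n<e)) (zeroʳ c)

  ‖‖≤-nonzero : ∀ {s n e} → ‖ s ‖≤ n → ¬ s e ≈ 0# → e ℤ.≤ n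
  ‖‖≤-nonzero ‖s‖≤n se≉0 = ℤP.≮⇒≥ (se≉0 ∘ ‖s‖≤n _)

  ‖‖≤-pred : ∀ {s n} → ‖ s ‖≤ n → s n ≈ 0# → ‖ s ‖≤ pred n
  ‖‖≤-pred {n = n} ‖s‖≤n sn≈0 e pred[n]<e with e ℤ.≟ n
  ... | yes ≡.refl = sn≈0
  ... | no  e≢n    = ‖s‖≤n e (ℤP.≤∧≢⇒< (pred<⇒≤ pred[n]<e) (e≢n ∘ ≡.sym))

  Bounded : Series → Set
  Bounded s = ∃ (‖ s ‖≤_)

  bounded-family : ∀ {d} (s : Fin d → Series) → (∀ i → Bounded (s i)) → ∃ (‖ s ‖∞≤_)
  bounded-family {zero}  s _ = + 0 , λ ()
  bounded-family {suc d} s bounded with bounded zero | bounded-family (s ∘ suc) (bounded ∘ suc)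
  ... | B₀ , ‖s₀‖≤B₀ | B , ‖s‖≤B = B₀ ℤ.⊔ B , λ
    { zero    → ‖‖≤-mono (ℤP.i≤i⊔j B₀ B) ‖s₀‖≤B₀
    ; (suc i) → ‖‖≤-mono (ℤP.i≤j⊔i B₀ B) (‖s‖≤B i) }

  infixl 6 _+ₚ_ _-ₚ_
  infixl 7 _*ₚ_
  infixr 7 _·ₚ_

  _+ₚ_ _-ₚ_ _*ₚ_ : Poly F → Poly F → Poly F
  _+ₚ_ = addP F
  _-ₚ_ = subP F
  _*ₚ_ = mulP F

  _·ₚ_ : Carrier → Poly F → Poly F
  _·ₚ_ = scaleP F

  infix 4 _≈ₚ_
  record _≈ₚ_ (p q : Poly F) : Set where
    constructor coeffwise
    field coeff≈ : _≈P_ F p q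
  open _≈ₚ_ public

  ≈ₚ-setoid : Setoid 0ℓ 0ℓ
  ≈ₚ-setoid = record
    { _≈_           = _≈ₚ_
    ; isEquivalence = record
      { refl  = coeffwise λ _ → refl
      ; sym   = λ p≈q → coeffwise (sym ∘ coeff≈ p≈q)
      ; trans = λ p≈q q≈r → coeffwise λ k → trans (coeff≈ p≈q k) (coeff≈ q≈r k)
      }
    }

  open Setoid ≈ₚ-setoid public using () renaming (sym to ≈ₚ-sym; trans to ≈ₚ-trans)

  coeff-+ₚ : ∀ p q k → coeffP F (p +ₚ q) k ≈ coeffP F p k + coeffP F q k
  coeff-+ₚ []      q       k       = sym (+-identityˡ _)
  coeff-+ₚ (c ∷ p) []      k       = sym (+-identityʳ _)
  coeff-+ₚ (c ∷ p) (d ∷ q) zero    = refl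
  coeff-+ₚ (c ∷ p) (d ∷ q) (suc k) = coeff-+ₚ p q k

  coeff-·ₚ : ∀ c p k → coeffP F (c ·ₚ p) k ≈ c * coeffP F p k
  coeff-·ₚ c []      k       = sym (zeroʳ c)
  coeff-·ₚ c (d ∷ p) zero    = refl
  coeff-·ₚ c (d ∷ p) (suc k) = coeff-·ₚ c p k

  coeff-negP : ∀ p k → coeffP F (negP F p) k ≈ - coeffP F p k
  coeff-negP []      k       = sym -0#≈0#
  coeff-negP (c ∷ p) zero    = refl
  coeff-negP (c ∷ p) (suc k) = coeff-negP p k

  coeff--ₚ : ∀ p q k → coeffP F (p -ₚ q) k ≈ coeffP F p k - coeffP F q k
  coeff--ₚ p q k = trans (coeff-+ₚ p (negP F q) k) (+-congˡ (coeff-negP q k))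

  IsZero : Poly F → Set
  IsZero p = ∀ k → coeffP F p k ≈ 0#

  -ₚ≈0⇒≈P : ∀ p q → IsZero (p -ₚ q) → _≈P_ F p q
  -ₚ≈0⇒≈P p q p-q≈0 k = x∙y⁻¹≈ε⇒x≈y _ _ (trans (sym (coeff--ₚ p q k)) (p-q≈0 k))

  DegreeBelow : Poly F → ℕ → Set
  DegreeBelow p m = ∀ k → m ℕ.≤ k → coeffP F p k ≈ 0#

  record HasDegree (p : Poly F) (m : ℕ) : Set where
    constructor has-degree
    field
      leading≉0 : ¬ coeffP F p m ≈ 0#
      below     : DegreeBelow p (suc m)
  open HasDegree public

  DegreeBelow-length : ∀ p → DegreeBelow p (length p)
  DegreeBelow-length []      k       _         = refl
  DegreeBelow-length (c ∷ p) (suc k) (s≤s l≤k) = DegreeBelow-length p k l≤k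

  DegreeSpec : Poly F → Maybe ℕ → Set
  DegreeSpec p nothing  = IsZero p
  DegreeSpec p (just m) = HasDegree p m

  deg-spec : ∀ p → DegreeSpec p (deg F p)
  deg-spec []      = λ _ → refl
  deg-spec (c ∷ p) with deg F p | deg-spec p
  ... | just m  | has-degree pₘ≉0 p<1+m = has-degree pₘ≉0 λ { (suc k) (s≤s m<k) → p<1+m k m<k }
  ... | nothing | p≈0 with c ≟ 0#
  ...   | yes c≈0 = λ { zero → c≈0 ; (suc k) → p≈0 k }
  ...   | no  c≉0 = has-degree c≉0 λ { (suc k) _ → p≈0 k }

  deg≡just⇒HasDegree : ∀ p {m} → deg F p ≡ just m → HasDegree p m
  deg≡just⇒HasDegree p eq = ≡.subst (DegreeSpec p) eq (deg-spec p)

  nonzero⇒deg≡just : ∀ p → ¬ IsZero p → ∃ λ m → deg F p ≡ just m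
  nonzero⇒deg≡just p p≉0 with deg F p | deg-spec p
  ... | nothing | p≈0 = ⊥-elim (p≉0 p≈0)
  ... | just m  | _   = m , ≡.refl

  nonzero⇒HasDegree : ∀ p → ¬ IsZero p → ∃ (HasDegree p)
  nonzero⇒HasDegree p p≉0 with nonzero⇒deg≡just p p≉0
  ... | m , deg≡m = m , deg≡just⇒HasDegree p deg≡m

  zero? : ∀ p → Dec (IsZero p)
  zero? p with deg F p | deg-spec p
  ... | nothing | p≈0 = yes p≈0
  ... | just m  | p°m = no λ p≈0 → leading≉0 p°m (p≈0 m)

  deg≤ᴰ⇒DegreeBelow : ∀ p {m} → _≤ᴰ_ F (deg F p) (just m) → DegreeBelow p (suc m)
  deg≤ᴰ⇒DegreeBelow p deg≤m with deg F p | deg-spec p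
  ... | nothing | p≈0 = λ k _ → p≈0 k
  ... | just k  | p°k = λ j m<j → below p°k j (ℕP.≤-<-trans deg≤m m<j)

  DegreeBelow⇒deg<ᴰ : ∀ {p q m} → DegreeBelow q m → deg F p ≡ just m → _<ᴰ_ F (deg F q) (deg F p)
  DegreeBelow⇒deg<ᴰ {q = q} q<m eq rewrite eq with deg F q | deg-spec q
  ... | nothing | _   = λ ()
  ... | just k  | q°k = λ m≤k → leading≉0 q°k (q<m k m≤k)

  deg-oneP : deg F (oneP F) ≡ just 0
  deg-oneP with 1# ≟ 0#
  ... | yes 1≈0 = ⊥-elim (1≉0 1≈0)
  ... | no  _   = ≡.refl

  infixr 7 _*ₛ_
  _*ₛ_ : Poly F → Series → Series
  ([]      *ₛ s) e = 0#
  ((c ∷ p) *ₛ s) e = c * s e + (p *ₛ s) (pred e)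

  mulPS≈*ₛ : ∀ p θ → mulPS F p θ ≈ₛ p *ₛ coeff θ
  mulPS≈*ₛ []      θ = pointwise λ _ → refl
  mulPS≈*ₛ (c ∷ p) θ = pointwise λ e → +-congˡ (trans (at (mulPS≈*ₛ p θ) _)
    (reflexive (≡.cong (p *ₛ coeff θ) (ℤP.+-comm e (ℤ.- + 1)))))

  IsZero⇒*ₛ≈0 : ∀ p → IsZero p → ∀ s e → (p *ₛ s) e ≈ 0#
  IsZero⇒*ₛ≈0 []      _   s e = refl
  IsZero⇒*ₛ≈0 (c ∷ p) p≈0 s e = trans
    (+-cong (trans (*-congʳ (p≈0 0)) (zeroˡ _)) (IsZero⇒*ₛ≈0 p (p≈0 ∘ suc) s (pred e)))
    (+-identityˡ 0#)

  *ₛ-zeroʳ : ∀ p {s} → (∀ e → s e ≈ 0#) → ∀ e → (p *ₛ s) e ≈ 0#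
  *ₛ-zeroʳ []      s≈0 e = refl
  *ₛ-zeroʳ (c ∷ p) s≈0 e = trans
    (+-cong (trans (*-congˡ (s≈0 e)) (zeroʳ c)) (*ₛ-zeroʳ p s≈0 (pred e)))
    (+-identityˡ 0#)

  *ₛ-congˡ : ∀ {p q} s → p ≈ₚ q → p *ₛ s ≈ₛ q *ₛ s
  *ₛ-congˡ {[]}    {[]}    s p≈q = ≈ₛ-refl
  *ₛ-congˡ {[]}    {d ∷ q} s p≈q = pointwise λ e → sym (IsZero⇒*ₛ≈0 (d ∷ q) (sym ∘ coeff≈ p≈q) s e)
  *ₛ-congˡ {c ∷ p} {[]}    s p≈q = pointwise (IsZero⇒*ₛ≈0 (c ∷ p) (coeff≈ p≈q) s)
  *ₛ-congˡ {c ∷ p} {d ∷ q} s p≈q = pointwise λ e →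
    +-cong (*-congʳ (coeff≈ p≈q 0)) (at (*ₛ-congˡ {p} {q} s (coeffwise (coeff≈ p≈q ∘ suc))) (pred e))

  *ₛ-congʳ : ∀ p {s t} → s ≈ₛ t → p *ₛ s ≈ₛ p *ₛ t
  *ₛ-congʳ []      s≈t = ≈ₛ-refl
  *ₛ-congʳ (c ∷ p) s≈t = pointwise λ e → +-cong (*-congˡ (at s≈t e)) (at (*ₛ-congʳ p s≈t) (pred e))

  +ₚ-*ₛ : ∀ p q s → (p +ₚ q) *ₛ s ≈ₛ p *ₛ s +ₛ q *ₛ s
  +ₚ-*ₛ []      q       s = pointwise λ _ → sym (+-identityˡ _)
  +ₚ-*ₛ (c ∷ p) []      s = pointwise λ _ → sym (+-identityʳ _)
  +ₚ-*ₛ (c ∷ p) (d ∷ q) s = pointwise λ e → begin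
    (c + d) * s e + ((p +ₚ q) *ₛ s) (pred e)
      ≈⟨ +-cong (distribʳ (s e) c d) (at (+ₚ-*ₛ p q s) (pred e)) ⟩
    (c * s e + d * s e) + ((p *ₛ s) (pred e) + (q *ₛ s) (pred e))
      ≈⟨ interchange _ _ _ _ ⟩
    ((c ∷ p) *ₛ s) e + ((d ∷ q) *ₛ s) e ∎
    where open ≈-Reasoning

  ·ₚ-*ₛ : ∀ c p s → (c ·ₚ p) *ₛ s ≈ₛ c ·ₛ (p *ₛ s)
  ·ₚ-*ₛ c []      s = pointwise λ _ → sym (zeroʳ c)
  ·ₚ-*ₛ c (d ∷ p) s = pointwise λ e → begin
    (c * d) * s e + ((c ·ₚ p) *ₛ s) (pred e) ≈⟨ +-cong (*-assoc c d (s e)) (at (·ₚ-*ₛ c p s) (pred e)) ⟩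
    c * (d * s e) + c * (p *ₛ s) (pred e)    ≈⟨ sym (distribˡ c _ _) ⟩
    c * ((d ∷ p) *ₛ s) e                     ∎
    where open ≈-Reasoning

  negP-*ₛ : ∀ p s → negP F p *ₛ s ≈ₛ -ₛ (p *ₛ s)
  negP-*ₛ []      s = pointwise λ _ → sym -0#≈0#
  negP-*ₛ (c ∷ p) s = pointwise λ e → begin
    (- c) * s e + (negP F p *ₛ s) (pred e) ≈⟨ +-cong (sym (-‿distribˡ-* c (s e))) (at (negP-*ₛ p s) (pred e)) ⟩
    - (c * s e) + - (p *ₛ s) (pred e)      ≈⟨ -‿+-comm _ _ ⟩
    - ((c ∷ p) *ₛ s) e                     ∎
    where open ≈-Reasoning

  -ₚ-*ₛ : ∀ p q s → (p -ₚ q) *ₛ s ≈ₛ p *ₛ s -ₛ q *ₛ s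
  -ₚ-*ₛ p q s = ≈ₛ-trans (+ₚ-*ₛ p (negP F q) s) (pointwise λ e → +-congˡ (at (negP-*ₛ q s) e))

  *ₛ-+ₛ : ∀ p s t → p *ₛ (s +ₛ t) ≈ₛ p *ₛ s +ₛ p *ₛ t
  *ₛ-+ₛ []      s t = pointwise λ _ → sym (+-identityˡ 0#)
  *ₛ-+ₛ (c ∷ p) s t = pointwise λ e → begin
    c * (s e + t e) + (p *ₛ (s +ₛ t)) (pred e)
      ≈⟨ +-cong (distribˡ c (s e) (t e)) (at (*ₛ-+ₛ p s t) (pred e)) ⟩
    (c * s e + c * t e) + ((p *ₛ s) (pred e) + (p *ₛ t) (pred e))
      ≈⟨ interchange _ _ _ _ ⟩
    ((c ∷ p) *ₛ s) e + ((c ∷ p) *ₛ t) e ∎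
    where open ≈-Reasoning

  *ₛ-negₛ : ∀ p s → p *ₛ (-ₛ s) ≈ₛ -ₛ (p *ₛ s)
  *ₛ-negₛ []      s = pointwise λ _ → sym -0#≈0#
  *ₛ-negₛ (c ∷ p) s = pointwise λ e → begin
    c * - s e + (p *ₛ (-ₛ s)) (pred e) ≈⟨ +-cong (sym (-‿distribʳ-* c (s e))) (at (*ₛ-negₛ p s) (pred e)) ⟩
    - (c * s e) + - (p *ₛ s) (pred e)  ≈⟨ -‿+-comm _ _ ⟩
    - ((c ∷ p) *ₛ s) e                 ∎
    where open ≈-Reasoning

  *ₛ--ₛ : ∀ p s t → p *ₛ (s -ₛ t) ≈ₛ p *ₛ s -ₛ p *ₛ t
  *ₛ--ₛ p s t = ≈ₛ-trans (*ₛ-+ₛ p s (-ₛ t)) (pointwise λ e → +-congˡ (at (*ₛ-negₛ p t) e))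

  *ₛ-·ₛ : ∀ p c s → p *ₛ (c ·ₛ s) ≈ₛ c ·ₛ (p *ₛ s)
  *ₛ-·ₛ []      c s = pointwise λ _ → sym (zeroʳ c)
  *ₛ-·ₛ (d ∷ p) c s = pointwise λ e → begin
    d * (c * s e) + (p *ₛ (c ·ₛ s)) (pred e) ≈⟨ +-cong (x∙yz≈y∙xz d c (s e)) (at (*ₛ-·ₛ p c s) (pred e)) ⟩
    c * (d * s e) + c * (p *ₛ s) (pred e)    ≈⟨ sym (distribˡ c _ _) ⟩
    c * ((d ∷ p) *ₛ s) e                     ∎
    where open ≈-Reasoning

  *ₛ-pred : ∀ p s → p *ₛ (s ∘ pred) ≈ₛ (p *ₛ s) ∘ pred
  *ₛ-pred []      s = ≈ₛ-refl
  *ₛ-pred (c ∷ p) s = pointwise λ e → +-congˡ (at (*ₛ-pred p s) (pred e))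

  *ₛ-comm : ∀ p q s → p *ₛ q *ₛ s ≈ₛ q *ₛ p *ₛ s
  *ₛ-comm p []      s = pointwise (*ₛ-zeroʳ p (λ _ → refl))
  *ₛ-comm p (c ∷ q) s = begin
    p *ₛ (c ·ₛ s +ₛ (q *ₛ s) ∘ pred)      ≈⟨ *ₛ-+ₛ p _ _ ⟩
    p *ₛ c ·ₛ s +ₛ p *ₛ (q *ₛ s) ∘ pred   ≈⟨ +ₛ-cong (*ₛ-·ₛ p c s) (*ₛ-pred p (q *ₛ s)) ⟩
    c ·ₛ p *ₛ s +ₛ (p *ₛ q *ₛ s) ∘ pred   ≈⟨ pointwise (λ e → +-congˡ (at (*ₛ-comm p q s) (pred e))) ⟩
    (c ∷ q) *ₛ p *ₛ s                     ∎
    where open ≈ₛ-Reasoning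

  *ₚ-*ₛ : ∀ p q s → (p *ₚ q) *ₛ s ≈ₛ p *ₛ q *ₛ s
  *ₚ-*ₛ []      q s = ≈ₛ-refl
  *ₚ-*ₛ (c ∷ p) q s = begin
    (c ·ₚ q +ₚ (0# ∷ p *ₚ q)) *ₛ s          ≈⟨ +ₚ-*ₛ (c ·ₚ q) (0# ∷ p *ₚ q) s ⟩
    (c ·ₚ q) *ₛ s +ₛ (0# ∷ p *ₚ q) *ₛ s     ≈⟨ pointwise (λ e → +-cong (at (·ₚ-*ₛ c q s) e)
                                                 (trans (+-congʳ (zeroˡ _)) (+-identityˡ _))) ⟩
    c ·ₛ q *ₛ s +ₛ ((p *ₚ q) *ₛ s) ∘ pred   ≈⟨ pointwise (λ e → +-congˡ (at (*ₚ-*ₛ p q s) (pred e))) ⟩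
    (c ∷ p) *ₛ q *ₛ s                       ∎
    where open ≈ₛ-Reasoning

  oneP-*ₛ : ∀ s → oneP F *ₛ s ≈ₛ s
  oneP-*ₛ s = pointwise λ e → trans (+-identityʳ _) (*-identityˡ (s e))

  polyAt-cong : ∀ {p q} → p ≈ₚ q → polyAt F p ≈ₛ polyAt F q
  polyAt-cong p≈q = pointwise λ { (+ k) → coeff≈ p≈q k ; -[1+ _ ] → refl }

  polyAt-injective : ∀ {p q} → polyAt F p ≈ₛ polyAt F q → p ≈ₚ q
  polyAt-injective p≈q = coeffwise (at p≈q ∘ +_)

  polyAt-+ₚ : ∀ p q → polyAt F (p +ₚ q) ≈ₛ polyAt F p +ₛ polyAt F q
  polyAt-+ₚ p q = pointwise λ { (+ k) → coeff-+ₚ p q k ; -[1+ _ ] → sym (+-identityˡ 0#) }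

  polyAt-·ₚ : ∀ c p → polyAt F (c ·ₚ p) ≈ₛ c ·ₛ polyAt F p
  polyAt-·ₚ c p = pointwise λ { (+ k) → coeff-·ₚ c p k ; -[1+ _ ] → sym (zeroʳ c) }

  polyAt--ₚ : ∀ p q → polyAt F (p -ₚ q) ≈ₛ polyAt F p -ₛ polyAt F q
  polyAt--ₚ p q = pointwise λ
    { (+ k) → coeff--ₚ p q k ; -[1+ _ ] → sym (trans (+-congˡ -0#≈0#) (+-identityˡ 0#)) }

  polyAt-0∷ : ∀ p e → polyAt F (0# ∷ p) e ≈ polyAt F p (pred e)
  polyAt-0∷ p (+ zero)  = refl
  polyAt-0∷ p (+ suc k) = refl
  polyAt-0∷ p -[1+ k ]  = refl

  polyAt-*ₚ : ∀ p q → polyAt F (p *ₚ q) ≈ₛ p *ₛ polyAt F q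
  polyAt-*ₚ []      q = pointwise λ { (+ _) → refl ; -[1+ _ ] → refl }
  polyAt-*ₚ (c ∷ p) q = begin
    polyAt F (c ·ₚ q +ₚ (0# ∷ p *ₚ q))               ≈⟨ polyAt-+ₚ (c ·ₚ q) (0# ∷ p *ₚ q) ⟩
    polyAt F (c ·ₚ q) +ₛ polyAt F (0# ∷ p *ₚ q)      ≈⟨ +ₛ-cong (polyAt-·ₚ c q) (pointwise (polyAt-0∷ (p *ₚ q))) ⟩
    c ·ₛ polyAt F q +ₛ polyAt F (p *ₚ q) ∘ pred      ≈⟨ pointwise (λ e → +-congˡ (at (polyAt-*ₚ p q) (pred e))) ⟩
    (c ∷ p) *ₛ polyAt F q                            ∎
    where open ≈ₛ-Reasoning

  polyAt≈*ₛpolyAt-oneP : ∀ p → polyAt F p ≈ₛ p *ₛ polyAt F (oneP F)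
  polyAt≈*ₛpolyAt-oneP []      = pointwise λ { (+ _) → refl ; -[1+ _ ] → refl }
  polyAt≈*ₛpolyAt-oneP (c ∷ p) = pointwise λ
    { (+ zero)  → sym (trans (+-congˡ (sym (at (polyAt≈*ₛpolyAt-oneP p) -[1+ 0 ])))
                             (trans (+-identityʳ _) (*-identityʳ c)))
    ; (+ suc k) → sym (trans (+-cong (zeroʳ c) (sym (at (polyAt≈*ₛpolyAt-oneP p) (+ k)))) (+-identityˡ _))
    ; -[1+ k ]  → sym (trans (+-cong (zeroʳ c) (sym (at (polyAt≈*ₛpolyAt-oneP p) -[1+ suc k ]))) (+-identityˡ _))
    }

  -- Identities between polynomials are read off from their action on series.
  *ₚ-comm : ∀ p q → p *ₚ q ≈ₚ q *ₚ p
  *ₚ-comm p q = polyAt-injective (begin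
    polyAt F (p *ₚ q)            ≈⟨ polyAt-*ₚ p q ⟩
    p *ₛ polyAt F q              ≈⟨ *ₛ-congʳ p (polyAt≈*ₛpolyAt-oneP q) ⟩
    p *ₛ q *ₛ polyAt F (oneP F)  ≈⟨ *ₛ-comm p q _ ⟩
    q *ₛ p *ₛ polyAt F (oneP F)  ≈˘⟨ *ₛ-congʳ q (polyAt≈*ₛpolyAt-oneP p) ⟩
    q *ₛ polyAt F p              ≈˘⟨ polyAt-*ₚ q p ⟩
    polyAt F (q *ₚ p)            ∎)
    where open ≈ₛ-Reasoning

  *ₚ-assoc : ∀ p q r → (p *ₚ q) *ₚ r ≈ₚ p *ₚ (q *ₚ r)
  *ₚ-assoc p q r = polyAt-injective (begin
    polyAt F ((p *ₚ q) *ₚ r)  ≈⟨ polyAt-*ₚ (p *ₚ q) r ⟩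
    (p *ₚ q) *ₛ polyAt F r    ≈⟨ *ₚ-*ₛ p q _ ⟩
    p *ₛ q *ₛ polyAt F r      ≈˘⟨ *ₛ-congʳ p (polyAt-*ₚ q r) ⟩
    p *ₛ polyAt F (q *ₚ r)    ≈˘⟨ polyAt-*ₚ p (q *ₚ r) ⟩
    polyAt F (p *ₚ (q *ₚ r))  ∎)
    where open ≈ₛ-Reasoning

  *ₚ-congʳ : ∀ p {q q′} → q ≈ₚ q′ → p *ₚ q ≈ₚ p *ₚ q′
  *ₚ-congʳ p {q} {q′} q≈q′ = polyAt-injective
    (≈ₛ-trans (polyAt-*ₚ p q) (≈ₛ-trans (*ₛ-congʳ p (polyAt-cong q≈q′)) (≈ₛ-sym (polyAt-*ₚ p q′))))

  *ₚ-identityʳ : ∀ p → p *ₚ oneP F ≈ₚ p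
  *ₚ-identityʳ p = polyAt-injective (≈ₛ-trans (polyAt-*ₚ p (oneP F)) (≈ₛ-sym (polyAt≈*ₛpolyAt-oneP p)))

  DegreeBelow⇔‖polyAt‖≤ : ∀ p m → DegreeBelow p m ⇔ ‖ polyAt F p ‖≤ pred (+ m)
  DegreeBelow⇔‖polyAt‖≤ p m = mk⇔
    (λ p<m → λ { (+ k) pred[m]<k → p<m k (ℤP.drop‿+≤+ (pred<⇒≤ pred[m]<k)) ; -[1+ _ ] _ → refl })
    (λ ‖p‖≤ k m≤k → ‖p‖≤ (+ k) (ℤP.<-≤-trans (pred[i]<i (+ m)) (+≤+ m≤k)))

  ‖polyAt‖≤⇔ : ∀ {p m n} → HasDegree p m → ‖ polyAt F p ‖≤ n ⇔ + m ℤ.≤ n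
  ‖polyAt‖≤⇔ {p} {m} (has-degree pₘ≉0 p<1+m) = mk⇔
    (λ ‖p‖≤n → ‖‖≤-nonzero ‖p‖≤n pₘ≉0)
    (λ m≤n → ‖‖≤-mono m≤n (Equivalence.to (DegreeBelow⇔‖polyAt‖≤ p (suc m)) p<1+m))

  ‖*ₛ‖≤ : ∀ p {m s n} → DegreeBelow p (suc m) → ‖ s ‖≤ n → ‖ p *ₛ s ‖≤ n ℤ.+ + m
  ‖*ₛ‖≤ []      _       _     e _ = refl
  ‖*ₛ‖≤ (c ∷ p) {zero} {s} {n} p<1 ‖s‖≤n e n+0<e = trans
    (+-cong (trans (*-congˡ (‖s‖≤n e (≡.subst (ℤ._< e) (ℤP.+-identityʳ n) n+0<e))) (zeroʳ c))
            (IsZero⇒*ₛ≈0 p (λ k → p<1 (suc k) (s≤s z≤n)) s (pred e)))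
    (+-identityˡ 0#)
  ‖*ₛ‖≤ (c ∷ p) {suc m} {s} {n} p<2+m ‖s‖≤n e n+1+m<e = trans
    (+-cong (trans (*-congˡ (‖s‖≤n e (ℤP.<-trans (i<i+1+k n m) n+1+m<e))) (zeroʳ c))
            (‖*ₛ‖≤ p (λ k m<k → p<2+m (suc k) (s≤s m<k)) ‖s‖≤n (pred e)
              (≡.subst (ℤ._< pred e) (pred[i+1+k]≡i+k n m) (ℤP.+-monoʳ-< (ℤ.- + 1) n+1+m<e))))
    (+-identityˡ 0#)

  *ₛ-top : ∀ p {m s e} → DegreeBelow p (suc m) → ‖ s ‖≤ e → (p *ₛ s) (e ℤ.+ + m) ≈ coeffP F p m * s e
  *ₛ-top []      _ _ = sym (zeroˡ _)
  *ₛ-top (c ∷ p) {zero} {s} {e} p<1 _ = trans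
    (+-cong (reflexive (≡.cong (λ x → c * s x) (ℤP.+-identityʳ e)))
            (IsZero⇒*ₛ≈0 p (λ k → p<1 (suc k) (s≤s z≤n)) s _))
    (+-identityʳ _)
  *ₛ-top (c ∷ p) {suc m} {s} {e} p<2+m ‖s‖≤e = trans
    (+-cong (trans (*-congˡ (‖s‖≤e _ (i<i+1+k e m))) (zeroʳ c))
            (trans (reflexive (≡.cong (p *ₛ s) (pred[i+1+k]≡i+k e m)))
                   (*ₛ-top p (λ k m<k → p<2+m (suc k) (s≤s m<k)) ‖s‖≤e)))
    (+-identityˡ _)

  ‖*ₛ‖≤-cancel : ∀ {p m s} n → HasDegree p m → Bounded s → ‖ p *ₛ s ‖≤ n ℤ.+ + m → ‖ s ‖≤ n
  ‖*ₛ‖≤-cancel {p} {m} {s} n (has-degree pₘ≉0 p<1+m) (B , ‖s‖≤B) ‖ps‖≤n+m =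
    downward-induction (‖ s ‖≤_) ‖‖≤-mono step ‖s‖≤B
    where
    step : ∀ N → n ℤ.< N → ‖ s ‖≤ N → ‖ s ‖≤ pred N
    step N n<N ‖s‖≤N = ‖‖≤-pred ‖s‖≤N (x*y≈0⇒y≈0 pₘ≉0
      (trans (sym (*ₛ-top p p<1+m ‖s‖≤N)) (‖ps‖≤n+m _ (ℤP.+-monoˡ-< (+ m) n<N))))

  bounded-polyAt : ∀ p → Bounded (polyAt F p)
  bounded-polyAt p =
    pred (+ length p) , Equivalence.to (DegreeBelow⇔‖polyAt‖≤ p (length p)) (DegreeBelow-length p)

  bounded-*ₛ : ∀ p {s} → Bounded s → Bounded (p *ₛ s)
  bounded-*ₛ p (B , ‖s‖≤B) = B ℤ.+ + length p , ‖*ₛ‖≤ p (λ k l<k → DegreeBelow-length p k (ℕP.<⇒≤ l<k)) ‖s‖≤B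

  bounded--ₛ : ∀ {s t} → Bounded s → Bounded t → Bounded (s -ₛ t)
  bounded--ₛ (B , ‖s‖≤B) (C , ‖t‖≤C) =
    B ℤ.⊔ C , ‖‖≤--ₛ (‖‖≤-mono (ℤP.i≤i⊔j B C) ‖s‖≤B) (‖‖≤-mono (ℤP.i≤j⊔i B C) ‖t‖≤C)

  *ₛ-cancelˡ : ∀ {g s t} → ¬ IsZero g → Bounded s → Bounded t → g *ₛ s ≈ₛ g *ₛ t → s ≈ₛ t
  *ₛ-cancelˡ {g} {s} {t} g≉0 s-bounded t-bounded gs≈gt with nonzero⇒HasDegree g g≉0
  ... | m , g°m = pointwise λ e → x∙y⁻¹≈ε⇒x≈y (s e) (t e)
    (‖*ₛ‖≤-cancel {s = s -ₛ t} (pred e) g°m (bounded--ₛ s-bounded t-bounded) ‖g[s-t]‖≤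
      e (pred[i]<i e))
    where
    ‖g[s-t]‖≤ : ∀ {N} → ‖ g *ₛ (s -ₛ t) ‖≤ N
    ‖g[s-t]‖≤ e _ = trans (at (*ₛ--ₛ g s t) e) (x≈y⇒x∙y⁻¹≈ε (at gs≈gt e))

  *ₚ-cancelˡ : ∀ {g p q} → ¬ IsZero g → g *ₚ p ≈ₚ g *ₚ q → p ≈ₚ q
  *ₚ-cancelˡ {g} {p} {q} g≉0 gp≈gq = polyAt-injective (*ₛ-cancelˡ {g} g≉0 (bounded-polyAt p) (bounded-polyAt q)
    (≈ₛ-trans (≈ₛ-sym (polyAt-*ₚ g p)) (≈ₛ-trans (polyAt-cong gp≈gq) (polyAt-*ₚ g q))))

  ‖*ₛ‖≤⇔ : ∀ {p m s} n → HasDegree p m → Bounded s → ‖ s ‖≤ n ⇔ ‖ p *ₛ s ‖≤ n ℤ.+ + m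
  ‖*ₛ‖≤⇔ {p} n p°m s-bounded = mk⇔ (‖*ₛ‖≤ p (below p°m)) (‖*ₛ‖≤-cancel {p} n p°m s-bounded)

  ‖*ₛ‖≤⇒‖‖≤ : ∀ {g s n} → ¬ IsZero g → Bounded s → ‖ g *ₛ s ‖≤ n → ‖ s ‖≤ n
  ‖*ₛ‖≤⇒‖‖≤ {g} {s} {n} g≉0 s-bounded ‖gs‖≤n with nonzero⇒HasDegree g g≉0
  ... | m , g°m = ‖*ₛ‖≤-cancel {g} {s = s} n g°m s-bounded (‖‖≤-mono (ℤP.i≤i+j n (+ m)) ‖gs‖≤n)

  ratLe⇔ : ∀ f {g β} n → deg F g ≡ just β → ratLe F f g n ⇔ ‖ polyAt F f ‖≤ n ℤ.+ + β
  ratLe⇔ f {g} {β} n deg≡β rewrite deg≡β with deg F f | deg-spec f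
  ... | nothing | f≈0 = mk⇔ (λ _ → λ { (+ k) _ → f≈0 k ; -[1+ _ ] _ → refl }) (λ _ → tt)
  ... | just m  | f°m = mk⇔
    (λ m-β≤n → Equivalence.from (‖polyAt‖≤⇔ f°m)
                 (≡.subst (ℤ._≤ n ℤ.+ + β) ([m-β]+β≡m (+ m) (+ β)) (ℤP.+-monoˡ-≤ (+ β) m-β≤n)))
    (λ ‖f‖≤n+β → ≡.subst (+ m ℤ.- + β ℤ.≤_) ([n+β]-β≡n n (+ β))
                   (ℤP.+-monoˡ-≤ (ℤ.- + β) (Equivalence.to (‖polyAt‖≤⇔ f°m) ‖f‖≤n+β)))
    where
    [m-β]+β≡m : ∀ m β → (m ℤ.- β) ℤ.+ β ≡ m
    [m-β]+β≡m = ℤ-Solver.solve-∀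
    [n+β]-β≡n : ∀ n β → (n ℤ.+ β) ℤ.- β ≡ n
    [n+β]-β≡n = ℤ-Solver.solve-∀

  ‖+ₛ‖∞≤-dominated : ∀ {d} {X Y : Fin d → Series} →
    (∀ N → ‖ Y ‖∞≤ N → ‖ X ‖∞≤ pred N) → (∀ i → Bounded (Y i)) →
    ∀ K → ‖ (λ i → X i +ₛ Y i) ‖∞≤ K ⇔ ‖ Y ‖∞≤ K
  ‖+ₛ‖∞≤-dominated {X = X} {Y} X≺Y Y-bounded K = mk⇔
    (λ ‖X+Y‖≤K → downward-induction (‖ Y ‖∞≤_) (λ i≤j ‖Y‖≤i l → ‖‖≤-mono i≤j (‖Y‖≤i l))
                   (step ‖X+Y‖≤K) (proj₂ (bounded-family Y Y-bounded)))
    (λ ‖Y‖≤K i → ‖‖≤-+ₛ (‖‖≤-mono (ℤP.<⇒≤ pred[K]<K) (X≺Y K ‖Y‖≤K i)) (‖Y‖≤K i))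
    where
    pred[K]<K : pred K ℤ.< K
    pred[K]<K = pred[i]<i K
    step : ‖ (λ i → X i +ₛ Y i) ‖∞≤ K → ∀ N → K ℤ.< N → ‖ Y ‖∞≤ N → ‖ Y ‖∞≤ pred N
    step ‖X+Y‖≤K N K<N ‖Y‖≤N i = ‖‖≤-resp (pointwise λ e → xyx⁻¹≈y (X i e) (Y i e))
      (‖‖≤--ₛ (‖‖≤-mono (pred-monoʳ-< K<N) (‖X+Y‖≤K i)) (X≺Y N ‖Y‖≤N i))

  DegreeBelow-resp : ∀ {p q m} → p ≈ₚ q → DegreeBelow p m → DegreeBelow q m
  DegreeBelow-resp p≈q p<m k m≤k = trans (sym (coeff≈ p≈q k)) (p<m k m≤k)

  leading-term-reduction : ∀ {g m} (g°m : HasDegree g m) s → DegreeBelow s (suc m) →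
    DegreeBelow (s -ₚ (coeffP F s m * coeffP F g m ⁻¹⟨ leading≉0 g°m ⟩) ·ₚ g) m
  leading-term-reduction {g} {m} (has-degree gₘ≉0 g<1+m) s s<1+m k m≤k = trans (coeff--ₚ s (c ·ₚ g) k)
    (x≈y⇒x∙y⁻¹≈ε (sym (trans (coeff-·ₚ c g k) (cancel (ℕP.m≤n⇒m<n∨m≡n m≤k)))))
    where
    c : Carrier
    c = coeffP F s m * coeffP F g m ⁻¹⟨ gₘ≉0 ⟩
    cancel : m ℕ.< k ⊎ m ≡ k → c * coeffP F g k ≈ coeffP F s k
    cancel (inj₁ m<k)    = trans (*-congˡ (g<1+m k m<k)) (trans (zeroʳ c) (sym (s<1+m k m<k)))
    cancel (inj₂ ≡.refl) = begin
      (coeffP F s m * coeffP F g m ⁻¹⟨ gₘ≉0 ⟩) * coeffP F g m ≈⟨ *-assoc _ _ _ ⟩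
      coeffP F s m * (coeffP F g m ⁻¹⟨ gₘ≉0 ⟩ * coeffP F g m)
        ≈⟨ *-congˡ (trans (*-comm _ _) (proj₂ (inverse _ gₘ≉0))) ⟩
      coeffP F s m * 1#                                      ≈⟨ *-identityʳ _ ⟩
      coeffP F s m                                           ∎
      where open ≈-Reasoning

  -- Recursion on the list c ∷ p = c + x p: dividing p first, c + x (p - q g) needs one more
  -- leading-term reduction.
  division : ∀ {g m} → HasDegree g m → ∀ p → ∃ λ q → DegreeBelow (p -ₚ q *ₚ g) m
  division g°m []      = [] , λ _ _ → refl
  division {g} {m} g°m (c ∷ p) with division g°m p
  ... | q , r<m = e ∷ q , DegreeBelow-resp (≈ₚ-sym shift-remainder) (leading-term-reduction g°m (c ∷ r) c∷r<1+m)
    where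
    r : Poly F
    r = p -ₚ q *ₚ g
    e : Carrier
    e = coeffP F (c ∷ r) m * coeffP F g m ⁻¹⟨ leading≉0 g°m ⟩
    c∷r<1+m : DegreeBelow (c ∷ r) (suc m)
    c∷r<1+m (suc k) (s≤s m≤k) = r<m k m≤k
    c∷r≈ : ∀ k → coeffP F (c ∷ r) k ≈ coeffP F (c ∷ p) k - coeffP F (0# ∷ q *ₚ g) k
    c∷r≈ zero    = sym (trans (+-congˡ -0#≈0#) (+-identityʳ c))
    c∷r≈ (suc k) = coeff--ₚ p (q *ₚ g) k
    shift-remainder : (c ∷ p) -ₚ (e ∷ q) *ₚ g ≈ₚ (c ∷ r) -ₚ e ·ₚ g
    shift-remainder = coeffwise λ k → begin
      coeffP F ((c ∷ p) -ₚ (e ·ₚ g +ₚ (0# ∷ q *ₚ g))) k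
        ≈⟨ trans (coeff--ₚ (c ∷ p) ((e ∷ q) *ₚ g) k) (+-congˡ (-‿cong (coeff-+ₚ (e ·ₚ g) (0# ∷ q *ₚ g) k))) ⟩
      coeffP F (c ∷ p) k - (coeffP F (e ·ₚ g) k + coeffP F (0# ∷ q *ₚ g) k)
        ≈⟨ x-[y+z]≈[x-z]-y _ _ _ ⟩
      (coeffP F (c ∷ p) k - coeffP F (0# ∷ q *ₚ g) k) - coeffP F (e ·ₚ g) k
        ≈⟨ trans (+-congʳ (sym (c∷r≈ k))) (sym (coeff--ₚ (c ∷ r) (e ·ₚ g) k)) ⟩
      coeffP F ((c ∷ r) -ₚ e ·ₚ g) k ∎
      where open ≈-Reasoning

  infix 4 _∣ₚ_
  _∣ₚ_ : Poly F → Poly F → Set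
  _∣ₚ_ = _∣P_ F

  ∣ₚ--ₚ*ₚ : ∀ {h f g} q → h ∣ₚ f → h ∣ₚ g → h ∣ₚ f -ₚ q *ₚ g
  ∣ₚ--ₚ*ₚ {h} {f} {g} q (s , hs≈f) (t , ht≈g) = s -ₚ q *ₚ t , coeff≈ (polyAt-injective (begin
    polyAt F (h *ₚ (s -ₚ q *ₚ t))                   ≈⟨ polyAt-*ₚ h (s -ₚ q *ₚ t) ⟩
    h *ₛ polyAt F (s -ₚ q *ₚ t)                     ≈⟨ *ₛ-congʳ h (polyAt--ₚ s (q *ₚ t)) ⟩
    h *ₛ (polyAt F s -ₛ polyAt F (q *ₚ t))          ≈⟨ *ₛ--ₛ h _ _ ⟩
    h *ₛ polyAt F s -ₛ h *ₛ polyAt F (q *ₚ t)       ≈⟨ -ₛ-cong (≈ₛ-sym (polyAt-*ₚ h s)) (*ₛ-congʳ h (polyAt-*ₚ q t)) ⟩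
    polyAt F (h *ₚ s) -ₛ h *ₛ q *ₛ polyAt F t       ≈⟨ -ₛ-cong (polyAt-cong (coeffwise hs≈f)) (*ₛ-comm h q _) ⟩
    polyAt F f -ₛ q *ₛ h *ₛ polyAt F t              ≈⟨ -ₛ-cong ≈ₛ-refl (*ₛ-congʳ q (≈ₛ-sym (polyAt-*ₚ h t))) ⟩
    polyAt F f -ₛ q *ₛ polyAt F (h *ₚ t)            ≈⟨ -ₛ-cong ≈ₛ-refl (*ₛ-congʳ q (polyAt-cong (coeffwise ht≈g))) ⟩
    polyAt F f -ₛ q *ₛ polyAt F g                   ≈˘⟨ -ₛ-cong ≈ₛ-refl (polyAt-*ₚ q g) ⟩
    polyAt F f -ₛ polyAt F (q *ₚ g)                 ≈˘⟨ polyAt--ₚ f (q *ₚ g) ⟩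
    polyAt F (f -ₚ q *ₚ g)                          ∎))
    where open ≈ₛ-Reasoning

  module _ {g m} (g°m : HasDegree g m) where

    quotient remainder : Poly F → Poly F
    quotient p  = proj₁ (division g°m p)
    remainder p = p -ₚ quotient p *ₚ g

    remainder-below : ∀ p → DegreeBelow (remainder p) m
    remainder-below p = proj₂ (division g°m p)

    remainder≈0⇒∣ₚ : ∀ p → IsZero (remainder p) → g ∣ₚ p
    remainder≈0⇒∣ₚ p r≈0 = quotient p , λ k → trans (coeff≈ (*ₚ-comm g (quotient p)) k)
      (sym (-ₚ≈0⇒≈P p (quotient p *ₚ g) r≈0 k))

  record IsGCD {n} (f : Fin n → Poly F) (g : Poly F) : Set where
    field
      nonzero  : ¬ IsZero g
      divides  : ∀ i → g ∣ₚ f i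
      greatest : ∀ h → (∀ i → h ∣ₚ f i) → h ∣ₚ g

  gcd : ∀ {n} (f : Fin n → Poly F) i → ¬ IsZero (f i) → ∃ (IsGCD f)
  gcd {n} f i fᵢ≉0 = euclid (proj₂ (nonzero⇒HasDegree (f i) fᵢ≉0)) (<-wellFounded _) (λ h h∣f → h∣f i)
    where
    euclid : ∀ {g m} → HasDegree g m → Acc ℕ._<_ m → (∀ h → (∀ i → h ∣ₚ f i) → h ∣ₚ g) → ∃ (IsGCD f)
    euclid {g} {m} g°m (acc smaller) greatest with all? (λ j → zero? (remainder g°m (f j)))
    ... | yes r≈0 = g , record
      { nonzero  = λ g≈0 → leading≉0 g°m (g≈0 m)
      ; divides  = λ j → remainder≈0⇒∣ₚ g°m (f j) (r≈0 j)
      ; greatest = greatest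
      }
    ... | no ¬r≈0 with ¬∀⟶∃¬ n _ (λ j → zero? (remainder g°m (f j))) ¬r≈0
    ...   | j , rⱼ≉0 with nonzero⇒HasDegree (remainder g°m (f j)) rⱼ≉0
    ...     | m′ , r°m′ = euclid r°m′ (smaller m′<m)
                (λ h h∣f → ∣ₚ--ₚ*ₚ {h} {f j} {g} (quotient g°m (f j)) (h∣f j) (greatest h h∣f))
      where
      m′<m : m′ ℕ.< m
      m′<m = ℕP.≰⇒> λ m≤m′ → leading≉0 r°m′ (remainder-below g°m (f j) m′ m≤m′)

  primitive-part : ∀ {d} (a : Fin d → Poly F) (b : Poly F) → ¬ IsZero b →
    ∃₂ λ g (w : QElem F d) → ¬ IsZero g × (∀ i → g *ₚ QElem.a w i ≈ₚ a i) × g *ₚ QElem.b w ≈ₚ b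
  primitive-part {d} a b b≉0 with gcd (b ∷ᶠ a) zero b≉0
  ... | g , g-gcd =
    g , w , nonzero , (λ i → coeffwise (proj₂ (divides (suc i)))) , coeffwise (proj₂ (divides zero))
    where
    open IsGCD g-gcd
    a′ : Fin d → Poly F
    a′ i = proj₁ (divides (suc i))
    b′ : Poly F
    b′ = proj₁ (divides zero)
    lift : ∀ h {x′} x → h ∣ₚ x′ → g *ₚ x′ ≈ₚ x → g *ₚ h ∣ₚ x
    lift h x (s , hs≈x′) gx′≈x =
      s , coeff≈ (≈ₚ-trans (*ₚ-assoc g h s) (≈ₚ-trans (*ₚ-congʳ g (coeffwise hs≈x′)) gx′≈x))
    coprime′ : ∀ h → (∀ i → h ∣ₚ a′ i) → h ∣ₚ b′ → IsUnitP F h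
    coprime′ h h∣a′ h∣b′ = k , coeff≈ (*ₚ-cancelˡ {g} nonzero
      (≈ₚ-trans (≈ₚ-sym (*ₚ-assoc g h k)) (≈ₚ-trans (coeffwise ghk≈g) (≈ₚ-sym (*ₚ-identityʳ g)))))
      where
      gh∣b∷a : ∀ j → g *ₚ h ∣ₚ (b ∷ᶠ a) j
      gh∣b∷a zero    = lift h b h∣b′ (coeffwise (proj₂ (divides zero)))
      gh∣b∷a (suc i) = lift h (a i) (h∣a′ i) (coeffwise (proj₂ (divides (suc i))))
      k : Poly F
      k = proj₁ (greatest (g *ₚ h) gh∣b∷a)
      ghk≈g : _≈P_ F ((g *ₚ h) *ₚ k) g
      ghk≈g = proj₂ (greatest (g *ₚ h) gh∣b∷a)
    b′≉0 : ¬ IsZero b′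
    b′≉0 b′≈0 = b≉0 λ k → trans (sym (proj₂ (divides zero) k))
      (trans (at (polyAt-*ₚ g b′) (+ k)) (*ₛ-zeroʳ g (λ { (+ j) → b′≈0 j ; -[1+ _ ] → refl }) (+ k)))
    w : QElem F d
    w = record { a = a′ ; b = b′ ; coprime = coprime′ ; b≢0 = b′≉0 }

  coeff-applyUpTo-< : ∀ f N k → k ℕ.< N → coeffP F (applyUpTo f N) k ≡ f k
  coeff-applyUpTo-< f (suc N) zero    _         = ≡.refl
  coeff-applyUpTo-< f (suc N) (suc k) (s≤s k<N) = coeff-applyUpTo-< (f ∘ suc) N k k<N

  coeff-applyUpTo-≥ : ∀ f N k → N ℕ.≤ k → coeffP F (applyUpTo f N) k ≡ 0#
  coeff-applyUpTo-≥ f zero    k       _         = ≡.refl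
  coeff-applyUpTo-≥ f (suc N) (suc k) (s≤s N≤k) = coeff-applyUpTo-≥ (f ∘ suc) N k N≤k

  integer-part : (θ : Laurent F) → ∃ λ p → ‖ coeff θ -ₛ polyAt F p ‖≤ -[1+ 0 ]
  integer-part θ = p , λ { (+ k) _ → θₖ-pₖ≈0 k ; -[1+ _ ] (ℤ.-<- ()) }
    where
    N : ℕ
    N = suc ℤ.∣ bound θ ∣
    p : Poly F
    p = applyUpTo (coeff θ ∘ +_) N
    θₖ-pₖ≈0 : ∀ k → coeff θ (+ k) - coeffP F p k ≈ 0#
    θₖ-pₖ≈0 k with k ℕ.<? N
    ... | yes k<N = x≈y⇒x∙y⁻¹≈ε (reflexive (≡.sym (coeff-applyUpTo-< (coeff θ ∘ +_) N k k<N)))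
    ... | no  k≮N = trans
      (+-cong (vanish θ (+ k) (∣i∣<k⇒i<+k (bound θ) (ℕP.≮⇒≥ k≮N)))
              (trans (-‿cong (reflexive (coeff-applyUpTo-≥ (coeff θ ∘ +_) N k (ℕP.≮⇒≥ k≮N)))) -0#≈0#))
      (+-identityˡ 0#)

  deg-b : ∀ {d} → QElem F d → ℕ
  deg-b u = proj₁ (nonzero⇒deg≡just (b u) (b≢0 u))

  deg≡deg-b : ∀ {d} (u : QElem F d) → deg F (b u) ≡ just (deg-b u)
  deg≡deg-b u = proj₂ (nonzero⇒deg≡just (b u) (b≢0 u))

  b-HasDegree : ∀ {d} (u : QElem F d) → HasDegree (b u) (deg-b u)
  b-HasDegree u = deg≡just⇒HasDegree (b u) (deg≡deg-b u)

  ≤Q⇒DegreeBelow : ∀ {d} (u v : QElem F d) → _≤Q_ F v u → DegreeBelow (b v) (suc (deg-b u))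
  ≤Q⇒DegreeBelow u v v≤u = deg≤ᴰ⇒DegreeBelow (b v) (≡.subst (_≤ᴰ_ F (deg F (b v))) (deg≡deg-b u) v≤u)

  module _ {d} (θ : Fin d → Laurent F) where

    -- A F θ w n unfolds to ‖ residual (a w) (b w) ‖∞≤ n.
    residual : (Fin d → Poly F) → Poly F → Fin d → Series
    residual a b i e = mulPS F b (θ i) e - polyAt F (a i) e

    residual≈ : ∀ a b i → residual a b i ≈ₛ b *ₛ coeff (θ i) -ₛ polyAt F (a i)
    residual≈ a b i = pointwise λ e → +-congʳ (at (mulPS≈*ₛ b (θ i)) e)

    residual-bounded : ∀ a b i → Bounded (residual a b i)
    residual-bounded a b i with bounded--ₛ (bounded-*ₛ b (bound (θ i) , vanish (θ i))) (bounded-polyAt (a i))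
    ... | B , ‖r‖≤B = B , ‖‖≤-resp (≈ₛ-sym (residual≈ a b i)) ‖r‖≤B

    residual-linear : ∀ c a b a′ b′ i →
      residual (λ j → a′ j -ₚ c ·ₚ a j) (b′ -ₚ c ·ₚ b) i ≈ₛ residual a′ b′ i -ₛ c ·ₛ residual a b i
    residual-linear c a b a′ b′ i = begin
      residual (λ j → a′ j -ₚ c ·ₚ a j) (b′ -ₚ c ·ₚ b) i
        ≈⟨ residual≈ (λ j → a′ j -ₚ c ·ₚ a j) (b′ -ₚ c ·ₚ b) i ⟩
      (b′ -ₚ c ·ₚ b) *ₛ θᵢ -ₛ polyAt F (a′ i -ₚ c ·ₚ a i)
        ≈⟨ -ₛ-cong (≈ₛ-trans (-ₚ-*ₛ b′ (c ·ₚ b) θᵢ) (-ₛ-cong ≈ₛ-refl (·ₚ-*ₛ c b θᵢ)))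
                   (≈ₛ-trans (polyAt--ₚ (a′ i) (c ·ₚ a i)) (-ₛ-cong ≈ₛ-refl (polyAt-·ₚ c (a i)))) ⟩
      (b′ *ₛ θᵢ -ₛ c ·ₛ b *ₛ θᵢ) -ₛ (polyAt F (a′ i) -ₛ c ·ₛ polyAt F (a i))
        ≈⟨ pointwise (λ e →
             trans ([x-y]-[z-w]≈[x-z]-[y-w] _ _ _ _) (+-congˡ (-‿cong (sym (x[y-z]≈xy-xz c _ _))))) ⟩
      (b′ *ₛ θᵢ -ₛ polyAt F (a′ i)) -ₛ c ·ₛ (b *ₛ θᵢ -ₛ polyAt F (a i))
        ≈˘⟨ -ₛ-cong (residual≈ a′ b′ i) (pointwise λ e → *-congˡ (at (residual≈ a b i) e)) ⟩
      residual a′ b′ i -ₛ c ·ₛ residual a b i ∎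
      where
      open ≈ₛ-Reasoning
      θᵢ = coeff (θ i)

    residual-*ₚ : ∀ g {a b a′ b′} → (∀ i → g *ₚ a′ i ≈ₚ a i) → g *ₚ b′ ≈ₚ b →
      ∀ i → residual a b i ≈ₛ g *ₛ residual a′ b′ i
    residual-*ₚ g {a} {b} {a′} {b′} ga′≈a gb′≈b i = begin
      residual a b i                                   ≈⟨ residual≈ a b i ⟩
      b *ₛ θᵢ -ₛ polyAt F (a i)                        ≈˘⟨ -ₛ-cong (*ₛ-congˡ θᵢ gb′≈b) (polyAt-cong (ga′≈a i)) ⟩
      (g *ₚ b′) *ₛ θᵢ -ₛ polyAt F (g *ₚ a′ i)          ≈⟨ -ₛ-cong (*ₚ-*ₛ g b′ θᵢ) (polyAt-*ₚ g (a′ i)) ⟩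
      g *ₛ b′ *ₛ θᵢ -ₛ g *ₛ polyAt F (a′ i)            ≈˘⟨ *ₛ--ₛ g _ _ ⟩
      g *ₛ (b′ *ₛ θᵢ -ₛ polyAt F (a′ i))               ≈˘⟨ *ₛ-congʳ g (residual≈ a′ b′ i) ⟩
      g *ₛ residual a′ b′ i                            ∎
      where
      open ≈ₛ-Reasoning
      θᵢ = coeff (θ i)

    residual-cross : ∀ a b a′ b′ i →
      b *ₛ residual a′ b′ i ≈ₛ b′ *ₛ residual a b i +ₛ polyAt F (b′ *ₚ a i -ₚ a′ i *ₚ b)
    residual-cross a b a′ b′ i = begin
      b *ₛ residual a′ b′ i                               ≈⟨ *ₛ-congʳ b (residual≈ a′ b′ i) ⟩
      b *ₛ (b′ *ₛ θᵢ -ₛ polyAt F (a′ i))                  ≈⟨ *ₛ--ₛ b _ _ ⟩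
      b *ₛ b′ *ₛ θᵢ -ₛ b *ₛ polyAt F (a′ i)               ≈⟨ -ₛ-cong (*ₛ-comm b b′ θᵢ) b*ₛa′≈a′*ₛb ⟩
      b′ *ₛ b *ₛ θᵢ -ₛ a′ i *ₛ polyAt F b                 ≈˘⟨ pointwise (λ e → [x-y]+[y-z]≈x-z _ _ _) ⟩
      (b′ *ₛ b *ₛ θᵢ -ₛ b′ *ₛ polyAt F (a i)) +ₛ (b′ *ₛ polyAt F (a i) -ₛ a′ i *ₛ polyAt F b)
        ≈˘⟨ +ₛ-cong (≈ₛ-trans (*ₛ-congʳ b′ (residual≈ a b i)) (*ₛ--ₛ b′ _ _))
                    (≈ₛ-trans (polyAt--ₚ _ _) (-ₛ-cong (polyAt-*ₚ b′ (a i)) (polyAt-*ₚ (a′ i) b))) ⟩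
      b′ *ₛ residual a b i +ₛ polyAt F (b′ *ₚ a i -ₚ a′ i *ₚ b) ∎
      where
      open ≈ₛ-Reasoning
      θᵢ = coeff (θ i)
      b*ₛa′≈a′*ₛb : b *ₛ polyAt F (a′ i) ≈ₛ a′ i *ₛ polyAt F b
      b*ₛa′≈a′*ₛb = ≈ₛ-trans (≈ₛ-sym (polyAt-*ₚ b (a′ i)))
                      (≈ₛ-trans (polyAt-cong (*ₚ-comm b (a′ i))) (polyAt-*ₚ (a′ i) b))

    residual-IsZero : ∀ {a b} → IsZero b → ‖ residual a b ‖∞≤ -[1+ 0 ] → ∀ i → IsZero (a i)
    residual-IsZero {a} {b} b≈0 ‖r‖<1 i k = trans
      (sym (x∙y⁻¹≈ε⇒x≈y _ _ (‖r‖<1 i (+ k) ℤ.-<+)))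
      (trans (at (mulPS≈*ₛ b (θ i)) (+ k)) (IsZero⇒*ₛ≈0 b b≈0 _ (+ k)))

    trivial-approximation : QElem F d
    trivial-approximation = record
      { a       = λ i → proj₁ (integer-part (θ i))
      ; b       = oneP F
      ; coprime = λ _ _ g∣1 → g∣1
      ; b≢0     = λ 1≈0 → 1≉0 (1≈0 0)
      }

    A-trivial-approximation : A F θ trivial-approximation -[1+ 0 ]
    A-trivial-approximation i = ‖‖≤-resp
      (≈ₛ-sym (≈ₛ-trans (residual≈ (QElem.a trivial-approximation) (oneP F) i)
                        (-ₛ-cong (oneP-*ₛ (coeff (θ i))) ≈ₛ-refl)))
      (proj₂ (integer-part (θ i)))

    best-approx-A<1 : ∀ {u} → IsBestApprox F θ u → A F θ u -[1+ 0 ]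
    best-approx-A<1 {u} (_ , nonstrict) = nonstrict trivial-approximation
      (≡.subst₂ (_≤ᴰ_ F) (≡.sym deg-oneP) (≡.sym (deg≡deg-b u)) z≤n) -[1+ 0 ] A-trivial-approximation

    primitive-approximation : ∀ a b → ¬ IsZero b →
      ∃ λ (w : QElem F d) → (∀ n → ‖ residual a b ‖∞≤ n → A F θ w n)
                          × (∀ m → DegreeBelow b m → DegreeBelow (QElem.b w) m)
    primitive-approximation a b b≉0 with primitive-part a b b≉0
    ... | g , w , g≉0 , ga′≈a , gb′≈b = w , A-w≤ , b-w<
      where
      A-w≤ : ∀ n → ‖ residual a b ‖∞≤ n → A F θ w n
      A-w≤ n ‖r‖≤n i = ‖*ₛ‖≤⇒‖‖≤ {g} g≉0 (residual-bounded (QElem.a w) (QElem.b w) i)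
        (‖‖≤-resp (residual-*ₚ g ga′≈a gb′≈b i) (‖r‖≤n i))
      b-w< : ∀ m → DegreeBelow b m → DegreeBelow (QElem.b w) m
      b-w< m b<m = Equivalence.from (DegreeBelow⇔‖polyAt‖≤ (QElem.b w) m)
        (‖*ₛ‖≤⇒‖‖≤ {g} g≉0 (bounded-polyAt (QElem.b w))
          (‖‖≤-resp (≈ₛ-trans (polyAt-cong (≈ₚ-sym gb′≈b)) (polyAt-*ₚ g (QElem.b w)))
            (Equivalence.to (DegreeBelow⇔‖polyAt‖≤ b m) b<m)))

    best-approx-strictly-closer : ∀ {u v} → IsBestApprox F θ u → _≤Q_ F v u → ¬ InScalarMultiples F v u →
      ¬ _≤ᴺ_ F (A F θ v) (A F θ u)
    best-approx-strictly-closer {u} {v} best v≤u v∉F*u Av≤Au = case zero? b-w of λ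
      { (yes b-w≈0) → v∉F*u (c , c≉0 b-w≈0
                            , (λ i → -ₚ≈0⇒≈P (a v i) (c ·ₚ a u i) (a-w≈0 b-w≈0 i))
                            , -ₚ≈0⇒≈P (b v) (c ·ₚ b u) b-w≈0)
      ; (no  b-w≉0) →
          let w , A-w≤ , b-w<⇒ = primitive-approximation a-w b-w b-w≉0
              n , Au , ¬Aw      = proj₁ best w
                (DegreeBelow⇒deg<ᴰ {b u} {QElem.b w} (b-w<⇒ β b-w<β) (deg≡deg-b u))
          in ¬Aw (A-w≤ n (A-w≤A-u n Au))
      }
      where
      β : ℕ
      β = deg-b u
      c : Carrier
      c = coeffP F (b v) β * coeffP F (b u) β ⁻¹⟨ leading≉0 (b-HasDegree u) ⟩
      a-w : Fin d → Poly F
      a-w i = a v i -ₚ c ·ₚ a u i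
      b-w : Poly F
      b-w = b v -ₚ c ·ₚ b u
      A-w≤A-u : ∀ n → A F θ u n → ‖ residual a-w b-w ‖∞≤ n
      A-w≤A-u n Au i = ‖‖≤-resp (≈ₛ-sym (residual-linear c (a u) (b u) (a v) (b v) i))
        (‖‖≤--ₛ (Av≤Au n Au i) (‖‖≤-·ₛ c (Au i)))
      b-w<β : DegreeBelow b-w β
      b-w<β = leading-term-reduction (b-HasDegree u) (b v) (≤Q⇒DegreeBelow u v v≤u)
      a-w≈0 : IsZero b-w → ∀ i → IsZero (a-w i)
      a-w≈0 b-w≈0 = residual-IsZero {a-w} {b-w} b-w≈0 (A-w≤A-u -[1+ 0 ] (best-approx-A<1 {u} best))
      c≉0 : IsZero b-w → ¬ c ≈ 0#
      c≉0 b-w≈0 c≈0 = b≢0 v λ k → trans (-ₚ≈0⇒≈P (b v) (c ·ₚ b u) b-w≈0 k)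
        (trans (coeff-·ₚ c (b u) k) (trans (*-congʳ c≈0) (zeroˡ _)))

    residual-dominated : ∀ {u v} → IsBestApprox F θ u → _≤Q_ F v u → ¬ InScalarMultiples F v u →
      ∀ N → ‖ (λ i → polyAt F (b v *ₚ a u i -ₚ a v i *ₚ b u)) ‖∞≤ N →
            ‖ (λ i → b v *ₛ residual (a u) (b u) i) ‖∞≤ pred N
    residual-dominated {u} {v} best v≤u v∉F*u N ‖D‖≤N i e pred[N]<e
      with (b v *ₛ residual (a u) (b u) i) e ≟ 0#
    ... | yes Xᵢₑ≈0 = Xᵢₑ≈0
    ... | no  Xᵢₑ≉0 = ⊥-elim (best-approx-strictly-closer {u} {v} best v≤u v∉F*u Av≤Au)
      where
      ‖X‖≤ : ∀ {m} → A F θ u m → ∀ j → ‖ b v *ₛ residual (a u) (b u) j ‖≤ m ℤ.+ + deg-b u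
      ‖X‖≤ Au j = ‖*ₛ‖≤ (b v) (≤Q⇒DegreeBelow u v v≤u) (Au j)
      Av≤Au : _≤ᴺ_ F (A F θ v) (A F θ u)
      Av≤Au m Au j = ‖*ₛ‖≤-cancel {b u} m (b-HasDegree u) (residual-bounded (a v) (b v) j)
        (‖‖≤-resp (≈ₛ-sym (residual-cross (a u) (b u) (a v) (b v) j)) (‖‖≤-+ₛ (‖X‖≤ Au j)
          (‖‖≤-mono (ℤP.≤-trans (pred<⇒≤ pred[N]<e) (‖‖≤-nonzero (‖X‖≤ Au i) Xᵢₑ≉0)) (‖D‖≤N j))))

    best-approx-A≡Ahat : ∀ {u v} → IsBestApprox F θ u → _≤Q_ F v u → ¬ InScalarMultiples F v u →
      _≡ᴺ_ F (A F θ v) (Ahat F u v)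
    best-approx-A≡Ahat {u} {v} best v≤u v∉F*u n = Equivalence.to A⇔Ahat , Equivalence.from A⇔Ahat
      where
      β : ℕ
      β = deg-b u
      D : Fin d → Poly F
      D i = b v *ₚ a u i -ₚ a v i *ₚ b u
      A⇔Ahat : A F θ v n ⇔ Ahat F u v n
      A⇔Ahat = begin
        ‖ residual (a v) (b v) ‖∞≤ n
          ≈⟨ ∀-⇔ (λ i → ‖*ₛ‖≤⇔ n (b-HasDegree u) (residual-bounded (a v) (b v) i)) ⟩
        ‖ (λ i → b u *ₛ residual (a v) (b v) i) ‖∞≤ n ℤ.+ + β
          ≈⟨ ∀-⇔ (λ i → mk⇔ (‖‖≤-resp (residual-cross (a u) (b u) (a v) (b v) i))
                            (‖‖≤-resp (≈ₛ-sym (residual-cross (a u) (b u) (a v) (b v) i)))) ⟩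
        ‖ (λ i → b v *ₛ residual (a u) (b u) i +ₛ polyAt F (D i)) ‖∞≤ n ℤ.+ + β
          ≈⟨ ‖+ₛ‖∞≤-dominated (residual-dominated {u} {v} best v≤u v∉F*u) (bounded-polyAt ∘ D) (n ℤ.+ + β) ⟩
        ‖ (λ i → polyAt F (D i)) ‖∞≤ n ℤ.+ + β
          ≈˘⟨ ∀-⇔ (λ i → ratLe⇔ (D i) {b u} n (deg≡deg-b u)) ⟩
        Ahat F u v n ∎
        where open SetoidReasoning (⇔-setoid 0ℓ)

lemma4p3 : (F : FiniteField) (d : ℕ) (θ : Fin d → Laurent F) (u : QElem F d) →
    IsBestApprox F θ u →
    (v : QElem F d) → _≤Q_ F v u → ¬ InScalarMultiples F v u →
    _≡ᴺ_ F (A F θ v) (Ahat F u v)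
lemma4p3 F d θ u best v v≤u v∉F*u = best-approx-A≡Ahat F θ {u} {v} best v≤u v∉F*u
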